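{- Let $n\geq 6$. There is a $3$-snake $(S_t)_{t=0}^T$ in $\{0,1\}^{n}$ of length $T$ such that all of the following hold: (1) $S_{T-3}=(1,0,1,0,1,0,\ldots,0)$ (first five coordinates $1,0,1,0,1$, remaining $n-5$ coordinates $0$); (2) $S_{T-2}=(1,0,1,0,\ldots,0)$ (first three coordinates $1,0,1$, remaining $n-3$ coordinates $0$); (3) $S_{T-1}=(1,0,\ldots,0)$; (4) $S_T=(0,\ldots,0)$; (5) $\|S_t\|>3$ for every $t<T-3$; (6) $T\geq s(n-1)$.
   Context: The hypercube $\{0,1\}^n$ is viewed as a graph with vertices adjacent iff they differ in exactly one coordinate; $d(x,y)$ is the graph distance (Hamming distance) and $\|x\|=\sum_i x_i$. A $3$-snake in $\{0,1\}^n$ is a path $(S_t)_{t=0}^T$ (consecutive terms adjacent) such that for all $t\geq 0$ and all $t'\in[t+3,T]$, $d(S_t,S_{t'})\geq 3$; $T$ is its length. $s(m)$ denotes the maximal length of a $3$-snake in $\{0,1\}^m$. -}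

module Defs where

open import Data.Bool using (Bool; true; false; if_then_else_)
open import Data.Nat using (ℕ; zero; suc; _+_; _≤_; _<_; _≡ᵇ_)
open import Data.Vec using (Vec; []; _∷_; tabulate)
open import Data.Fin using (Fin; toℕ)
open import Data.List using (List)
open import Data.Bool.ListAction using (any)
open import Data.Product using (_×_)
open import Relation.Binary.PropositionalEquality using (_≡_)

-- The hypercube {0,1}^n : vertices are Boolean vectors (true = 1, false = 0).
Cube : ℕ → Set
Cube n = Vec Bool n

dist : ∀ {n} → Cube n → Cube n → ℕ
dist [] [] = 0
dist (true ∷ x) (true ∷ y) = dist x y
dist (false ∷ x) (false ∷ y) = dist x y
dist (true ∷ x) (false ∷ y) = suc (dist x y)
dist (false ∷ x) (true ∷ y) = suc (dist x y)

norm : ∀ {n} → Cube n → ℕ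
norm [] = 0
norm (true ∷ x) = suc (norm x)
norm (false ∷ x) = norm x

Adjacent : ∀ {n} → Cube n → Cube n → Set
Adjacent x y = dist x y ≡ 1

-- A 3-snake (S_t)_{t=0}^T in {0,1}^n, with the sequence given as a function
-- ℕ → Cube n of which only the values at t ≤ T are relevant.
Is3Snake : (n : ℕ) → (ℕ → Cube n) → ℕ → Set
Is3Snake n S T =
  (∀ t → t < T → Adjacent (S t) (S (suc t))) ×
  (∀ t t' → t + 3 ≤ t' → t' ≤ T → 3 ≤ dist (S t) (S t'))

-- "s(m) ≤ T": every 3-snake in {0,1}^m has length at most T
-- (i.e. the maximal length s(m) of a 3-snake in {0,1}^m is ≤ T).
MaxSnakeLength≤ : ℕ → ℕ → Set
MaxSnakeLength≤ m T = ∀ (S : ℕ → Cube m) (T' : ℕ) → Is3Snake m S T' → T' ≤ T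

-- The vertex of {0,1}^n whose coordinates equal to 1 are exactly those with
-- (0-based) index in the given list.
pt : (n : ℕ) → List ℕ → Cube n
pt n ones = tabulate (λ (i : Fin n) → any (λ j → toℕ i ≡ᵇ j) ones)

-- Let R be a longest 3-snake in {0,1}^(n-1), of length L = s(n-1) ≥ 3; it exists because snake
-- lengths are bounded and having a snake of a given length is decidable. Its last two steps flip
-- different coordinates, so a translation followed by a permutation of coordinates moves its last
-- three vertices to e₁ + e₃, e₁, 0. Put this snake into the facet x₀ = 1 of {0,1}^n and add one
-- step to the origin: the new vertex has distance 1 + d(R t, R L) ≥ 3 from the vertex 1·R t for
-- t ≤ L - 2, and for t ≤ L - 3 that vertex has norm 1 + d(R t, R L) ≥ 4. The new snake is one step
-- longer than R, hence has length ≥ s(n-1).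

module Submission where

open import Defs
open import Algebra.Properties.CommutativeSemigroup using (interchange)
open import Data.Bool using (Bool; true; false; not; _xor_; if_then_else_)
open import Data.Bool.Properties using (not-involutive; xor-same; not-distribʳ-xor)
open import Data.Fin using (Fin; zero; suc; toℕ; _≟_)
import Data.Fin as Fin
open import Data.Fin.Permutation as Perm
  using (Permutation; _⟨$⟩ʳ_; _⟨$⟩ˡ_; _∘ₚ_; transpose; inverseˡ; inverseʳ)
open import Data.Fin.Properties using (pigeonhole; toℕ<n)
open import Data.List using (List; []; _∷_; length; lookup; cartesianProductWith)
open import Data.List.Membership.Propositional using (_∈_)
open import Data.List.Membership.Propositional.Properties using (∈-cartesianProductWith⁺)
open import Data.List.Relation.Unary.Any as Any using (here; there; any?; satisfied)
open import Data.List.Relation.Unary.Any.Properties using (lookup-index)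
open import Data.Nat using (ℕ; zero; suc; _+_; _*_; _∸_; _≤_; _<_; z≤n; s≤s; _≤?_)
open import Data.Nat.Properties hiding (_≟_)
open import Data.Nat.Properties using () renaming (_≟_ to _≟ℕ_)
open import Data.Product using (Σ; ∃; ∃₂; _×_; _,_)
import Data.Product as Product
open import Data.Sum using (inj₁; inj₂)
open import Data.Vec using (Vec; []; _∷_; tabulate; zipWith; updateAt)
import Data.Vec as Vec
open import Data.Vec.Properties
  using (lookup∘tabulate; tabulate∘lookup; tabulate-cong; lookup∘updateAt; lookup∘updateAt′;
         updateAt-updateAt; updateAt-id-local)
open import Function using (_∘_; id)
open import Relation.Binary.PropositionalEquality
open import Relation.Nullary using (¬_; Dec; yes; no; contradiction)
open import Relation.Nullary.Decidable using (map′; _×-dec_; _→-dec_; dec-true; dec-false)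
open import Relation.Unary using (Decidable)
open import Algebra.Properties.CommutativeMonoid.Sum +-0-commutativeMonoid
  using (sum; sum-cong-≗; sum-permute)

private variable
  m k : ℕ

-- Defined by tabulate, like pt, so that the vertices pt n ones of the theorem are reached by computation.
zeros : ∀ m → Cube m
zeros m = tabulate (λ _ → false)

flip : Fin m → Cube m → Cube m
flip i x = updateAt x i not

flip-involutive : ∀ (i : Fin m) x → flip i (flip i x) ≡ x
flip-involutive i x = trans (updateAt-updateAt i x) (updateAt-id-local i x (not-involutive _))

dist[x,x]≡0 : ∀ (x : Cube m) → dist x x ≡ 0
dist[x,x]≡0 [] = refl
dist[x,x]≡0 (true ∷ x) = dist[x,x]≡0 x
dist[x,x]≡0 (false ∷ x) = dist[x,x]≡0 x

dist≡0⇒≡ : ∀ (x y : Cube m) → dist x y ≡ 0 → x ≡ y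
dist≡0⇒≡ [] [] _ = refl
dist≡0⇒≡ (true ∷ x) (true ∷ y) d = cong (true ∷_) (dist≡0⇒≡ x y d)
dist≡0⇒≡ (false ∷ x) (false ∷ y) d = cong (false ∷_) (dist≡0⇒≡ x y d)
dist≡0⇒≡ (true ∷ x) (false ∷ y) ()
dist≡0⇒≡ (false ∷ x) (true ∷ y) ()

dist≡1⇒flip : ∀ (x y : Cube m) → dist x y ≡ 1 → ∃ λ i → x ≡ flip i y
dist≡1⇒flip [] [] ()
dist≡1⇒flip (true ∷ x) (true ∷ y) d = Product.map suc (cong (true ∷_)) (dist≡1⇒flip x y d)
dist≡1⇒flip (false ∷ x) (false ∷ y) d = Product.map suc (cong (false ∷_)) (dist≡1⇒flip x y d)
dist≡1⇒flip (true ∷ x) (false ∷ y) d = zero , cong (true ∷_) (dist≡0⇒≡ x y (suc-injective d))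
dist≡1⇒flip (false ∷ x) (true ∷ y) d = zero , cong (false ∷_) (dist≡0⇒≡ x y (suc-injective d))

norm≡dist-zeros : ∀ (x : Cube m) → norm x ≡ dist x (zeros m)
norm≡dist-zeros [] = refl
norm≡dist-zeros (true ∷ x) = cong suc (norm≡dist-zeros x)
norm≡dist-zeros (false ∷ x) = norm≡dist-zeros x

δ : Bool → Bool → ℕ
δ a b = if a xor b then 1 else 0

dist-∷ : ∀ a b (x y : Cube m) → dist (a ∷ x) (b ∷ y) ≡ δ a b + dist x y
dist-∷ true true x y = refl
dist-∷ true false x y = refl
dist-∷ false true x y = refl
dist-∷ false false x y = refl

dist≡sum : ∀ (x y : Cube m) → dist x y ≡ sum (λ i → δ (Vec.lookup x i) (Vec.lookup y i))
dist≡sum [] [] = refl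
dist≡sum (a ∷ x) (b ∷ y) = trans (dist-∷ a b x y) (cong (δ a b +_) (dist≡sum x y))

δ-triangle : ∀ a b c → δ a c ≤ δ a b + δ b c
δ-triangle false _ false = z≤n
δ-triangle true _ true = z≤n
δ-triangle false false true = s≤s z≤n
δ-triangle false true true = s≤s z≤n
δ-triangle true false false = s≤s z≤n
δ-triangle true true false = s≤s z≤n

dist-triangle : ∀ (x y z : Cube m) → dist x z ≤ dist x y + dist y z
dist-triangle [] [] [] = z≤n
dist-triangle (a ∷ x) (b ∷ y) (c ∷ z) = begin
  dist (a ∷ x) (c ∷ z)                         ≡⟨ dist-∷ a c x z ⟩
  δ a c + dist x z                             ≤⟨ +-mono-≤ (δ-triangle a b c) (dist-triangle x y z) ⟩
  (δ a b + δ b c) + (dist x y + dist y z)      ≡⟨ interchange +-commutativeSemigroup (δ a b) (δ b c) (dist x y) (dist y z) ⟩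
  (δ a b + dist x y) + (δ b c + dist y z)      ≡⟨ sym (cong₂ _+_ (dist-∷ a b x y) (dist-∷ b c y z)) ⟩
  dist (a ∷ x) (b ∷ y) + dist (b ∷ y) (c ∷ z)  ∎
  where open ≤-Reasoning

-- Automorphisms of the cube: translations and coordinate permutations

translate : Cube m → Cube m → Cube m
translate = zipWith _xor_

δ-translate : ∀ c a b → δ (c xor a) (c xor b) ≡ δ a b
δ-translate false a b = refl
δ-translate true true true = refl
δ-translate true true false = refl
δ-translate true false true = refl
δ-translate true false false = refl

dist-translate : ∀ (z x y : Cube m) → dist (translate z x) (translate z y) ≡ dist x y
dist-translate [] [] [] = refl
dist-translate (c ∷ z) (a ∷ x) (b ∷ y) = begin
  dist ((c xor a) ∷ translate z x) ((c xor b) ∷ translate z y)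
    ≡⟨ dist-∷ (c xor a) (c xor b) (translate z x) (translate z y) ⟩
  δ (c xor a) (c xor b) + dist (translate z x) (translate z y)
    ≡⟨ cong₂ _+_ (δ-translate c a b) (dist-translate z x y) ⟩
  δ a b + dist x y
    ≡⟨ dist-∷ a b x y ⟨
  dist (a ∷ x) (b ∷ y) ∎
  where open ≡-Reasoning

translate-self : ∀ (z : Cube m) → translate z z ≡ zeros m
translate-self [] = refl
translate-self (c ∷ z) = cong₂ _∷_ (xor-same c) (translate-self z)

translate-flip : ∀ (z : Cube m) i x → translate z (flip i x) ≡ flip i (translate z x)
translate-flip (c ∷ z) zero (a ∷ x) = cong (_∷ translate z x) (sym (not-distribʳ-xor c a))
translate-flip (c ∷ z) (suc i) (a ∷ x) = cong ((c xor a) ∷_) (translate-flip z i x)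

permute : Permutation m m → Cube m → Cube m
permute π x = tabulate (λ k → Vec.lookup x (π ⟨$⟩ˡ k))

lookup-permute : ∀ π (x : Cube m) k → Vec.lookup (permute π x) k ≡ Vec.lookup x (π ⟨$⟩ˡ k)
lookup-permute π x = lookup∘tabulate (λ k → Vec.lookup x (π ⟨$⟩ˡ k))

dist-permute : ∀ π (x y : Cube m) → dist (permute π x) (permute π y) ≡ dist x y
dist-permute π x y = begin
  dist (permute π x) (permute π y)
    ≡⟨ dist≡sum (permute π x) (permute π y) ⟩
  sum (λ k → δ (Vec.lookup (permute π x) k) (Vec.lookup (permute π y) k))
    ≡⟨ sum-cong-≗ (λ k → cong₂ δ (lookup-permute π x k) (lookup-permute π y k)) ⟩
  sum (λ k → δ (Vec.lookup x (π ⟨$⟩ˡ k)) (Vec.lookup y (π ⟨$⟩ˡ k)))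
    ≡⟨ sum-permute (λ k → δ (Vec.lookup x k) (Vec.lookup y k)) (Perm.flip π) ⟨
  sum (λ k → δ (Vec.lookup x k) (Vec.lookup y k))
    ≡⟨ dist≡sum x y ⟨
  dist x y ∎
  where open ≡-Reasoning

permute-zeros : ∀ (π : Permutation m m) → permute π (zeros m) ≡ zeros m
permute-zeros π = tabulate-cong (λ k → lookup∘tabulate _ (π ⟨$⟩ˡ k))

permute-flip : ∀ π (i : Fin m) x → permute π (flip i x) ≡ flip (π ⟨$⟩ʳ i) (permute π x)
permute-flip π i x = begin
  permute π (flip i x)                                       ≡⟨ tabulate∘lookup _ ⟨
  tabulate (Vec.lookup (permute π (flip i x)))               ≡⟨ tabulate-cong coordinate ⟩
  tabulate (Vec.lookup (flip (π ⟨$⟩ʳ i) (permute π x)))      ≡⟨ tabulate∘lookup _ ⟩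
  flip (π ⟨$⟩ʳ i) (permute π x)                              ∎
  where
  open ≡-Reasoning
  coordinate : ∀ k → Vec.lookup (permute π (flip i x)) k ≡ Vec.lookup (flip (π ⟨$⟩ʳ i) (permute π x)) k
  coordinate k with k ≟ π ⟨$⟩ʳ i
  ... | yes refl = begin
    Vec.lookup (permute π (flip i x)) (π ⟨$⟩ʳ i)   ≡⟨ lookup-permute π (flip i x) (π ⟨$⟩ʳ i) ⟩
    Vec.lookup (flip i x) (π ⟨$⟩ˡ (π ⟨$⟩ʳ i))      ≡⟨ cong (Vec.lookup (flip i x)) (inverseˡ π) ⟩
    Vec.lookup (flip i x) i                       ≡⟨ lookup∘updateAt i x ⟩
    not (Vec.lookup x i)                          ≡⟨ cong (not ∘ Vec.lookup x) (inverseˡ π) ⟨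
    not (Vec.lookup x (π ⟨$⟩ˡ (π ⟨$⟩ʳ i)))         ≡⟨ cong not (lookup-permute π x (π ⟨$⟩ʳ i)) ⟨
    not (Vec.lookup (permute π x) (π ⟨$⟩ʳ i))      ≡⟨ lookup∘updateAt _ (permute π x) ⟨
    Vec.lookup (flip (π ⟨$⟩ʳ i) (permute π x)) (π ⟨$⟩ʳ i) ∎
  ... | no k≢πi = begin
    Vec.lookup (permute π (flip i x)) k           ≡⟨ lookup-permute π (flip i x) k ⟩
    Vec.lookup (flip i x) (π ⟨$⟩ˡ k)              ≡⟨ lookup∘updateAt′ _ i π⁻¹k≢i x ⟩
    Vec.lookup x (π ⟨$⟩ˡ k)                       ≡⟨ lookup-permute π x k ⟨
    Vec.lookup (permute π x) k                    ≡⟨ lookup∘updateAt′ k (π ⟨$⟩ʳ i) k≢πi (permute π x) ⟨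
    Vec.lookup (flip (π ⟨$⟩ʳ i) (permute π x)) k  ∎
    where
    π⁻¹k≢i : π ⟨$⟩ˡ k ≢ i
    π⁻¹k≢i π⁻¹k≡i = k≢πi (trans (sym (inverseʳ π)) (cong (π ⟨$⟩ʳ_) π⁻¹k≡i))

transpose-sends : ∀ (i j : Fin m) → transpose i j ⟨$⟩ʳ i ≡ j
transpose-sends i j rewrite dec-true (i ≟ i) refl = refl

transpose-fixes : ∀ {i j k : Fin m} → k ≢ i → k ≢ j → transpose i j ⟨$⟩ʳ k ≡ k
transpose-fixes {i = i} {j} {k} k≢i k≢j rewrite dec-false (k ≟ i) k≢i | dec-false (k ≟ j) k≢j = refl

permutation-sending : ∀ {i j i′ j′ : Fin m} → i ≢ j → i′ ≢ j′ →
                      ∃ λ (π : Permutation m m) → π ⟨$⟩ʳ i ≡ i′ × π ⟨$⟩ʳ j ≡ j′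
permutation-sending {i = i} {j} {i′} {j′} i≢j i′≢j′ =
  τ ∘ₚ σ , trans (cong (σ ⟨$⟩ʳ_) (transpose-sends i i′)) (transpose-fixes i′≢τj i′≢j′)
         , transpose-sends (τ ⟨$⟩ʳ j) j′
  where
  τ σ : Permutation _ _
  τ = transpose i i′
  σ = transpose (τ ⟨$⟩ʳ j) j′
  i′≢τj : i′ ≢ τ ⟨$⟩ʳ j
  i′≢τj i′≡τj = i≢j (begin
    i                        ≡⟨ inverseˡ τ ⟨
    τ ⟨$⟩ˡ (τ ⟨$⟩ʳ i)         ≡⟨ cong (τ ⟨$⟩ˡ_) (trans (transpose-sends i i′) i′≡τj) ⟩
    τ ⟨$⟩ˡ (τ ⟨$⟩ʳ j)         ≡⟨ inverseˡ τ ⟩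
    j                        ∎)
    where open ≡-Reasoning

isometry-preserves-snake : ∀ {m′} {φ : Cube m → Cube m′} → (∀ x y → dist (φ x) (φ y) ≡ dist x y) →
                           ∀ {S T} → Is3Snake m S T → Is3Snake m′ (φ ∘ S) T
isometry-preserves-snake φ-isometry (adjacent , far) =
  (λ t t<T → trans (φ-isometry _ _) (adjacent t t<T)) ,
  (λ t t′ gap t′≤T → subst (3 ≤_) (sym (φ-isometry _ _)) (far t t′ gap t′≤T))

Is3Snake-cong : ∀ {S S′ : ℕ → Cube m} {T} → (∀ {t} → t ≤ T → S t ≡ S′ t) →
                Is3Snake m S T → Is3Snake m S′ T
Is3Snake-cong S≗S′ (adjacent , far) =
  (λ t t<T → subst₂ Adjacent (S≗S′ (<⇒≤ t<T)) (S≗S′ t<T) (adjacent t t<T)) ,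
  (λ t t′ gap t′≤T → subst₂ (λ x y → 3 ≤ dist x y)
     (S≗S′ (≤-trans (m≤m+n t 3) (≤-trans gap t′≤T))) (S≗S′ t′≤T) (far t t′ gap t′≤T))

dist-to-end : ∀ {R : ℕ → Cube m} {L} → Is3Snake m R L → 3 ≤ L → ∀ t → t + 2 ≤ L → 2 ≤ dist (R t) (R L)
dist-to-end (_ , far) 3≤L zero _ = ≤-trans (s≤s (s≤s z≤n)) (far 0 _ 3≤L ≤-refl)
dist-to-end {R = R} {L} (adjacent , far) _ (suc t) t+3≤L = ≤-pred (begin
  3                                                ≤⟨ far t L (subst (_≤ L) (sym (+-suc t 2)) t+3≤L) ≤-refl ⟩
  dist (R t) (R L)                                 ≤⟨ dist-triangle (R t) (R (suc t)) (R L) ⟩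
  dist (R t) (R (suc t)) + dist (R (suc t)) (R L)  ≡⟨ cong (_+ dist (R (suc t)) (R L)) (adjacent t t<L) ⟩
  suc (dist (R (suc t)) (R L))                     ∎)
  where
  open ≤-Reasoning
  t<L : t < L
  t<L = ≤-trans (s≤s (m≤m+n t 2)) t+3≤L

norm-from-end : ∀ {R : ℕ → Cube m} {L t} → Is3Snake m R L → R L ≡ zeros m → t + 3 ≤ L → 3 ≤ norm (R t)
norm-from-end {R = R} {L} {t} (_ , far) end gap =
  subst (3 ≤_) (sym (trans (norm≡dist-zeros (R t)) (cong (dist (R t)) (sym end)))) (far t L gap ≤-refl)

far-distinct : ∀ {S : ℕ → Cube m} {T t t′} → Is3Snake m S T → t + 3 ≤ t′ → t′ ≤ T → S t ≢ S t′
far-distinct {S = S} {t′ = t′} (_ , far) gap t′≤T St≡St′ =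
  contradiction (subst (3 ≤_) (dist[x,x]≡0 (S t′)) (subst (λ x → 3 ≤ dist x (S t′)) St≡St′ (far _ _ gap t′≤T)))
    λ ()

append : (ℕ → Cube m) → ℕ → Cube m → ℕ → Cube m
append S T v t with t ≤? T
... | yes _ = S t
... | no _ = v

append-≤ : ∀ (S : ℕ → Cube m) T v {t} → t ≤ T → append S T v t ≡ S t
append-≤ S T v {t} t≤T with t ≤? T
... | yes _ = refl
... | no t≰T = contradiction t≤T t≰T

append-last : ∀ (S : ℕ → Cube m) T v → append S T v (suc T) ≡ v
append-last S T v with suc T ≤? T
... | yes 1+T≤T = contradiction 1+T≤T 1+n≰n
... | no _ = refl

append-snake : ∀ {S : ℕ → Cube m} {T v} → Is3Snake m S T → Adjacent (S T) v →
               (∀ t → t + 2 ≤ T → 3 ≤ dist (S t) v) → Is3Snake m (append S T v) (suc T)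
append-snake {S = S} {T} {v} (adjacent , far) adjacent-v far-v = adjacent′ , far′
  where
  before : ∀ {t} → t ≤ T → S t ≡ append S T v t
  before t≤T = sym (append-≤ S T v t≤T)
  after : v ≡ append S T v (suc T)
  after = sym (append-last S T v)
  adjacent′ : ∀ t → t < suc T → Adjacent (append S T v t) (append S T v (suc t))
  adjacent′ t t<1+T with m<1+n⇒m<n∨m≡n t<1+T
  ... | inj₁ t<T = subst₂ Adjacent (before (<⇒≤ t<T)) (before t<T) (adjacent t t<T)
  ... | inj₂ refl = subst₂ Adjacent (before ≤-refl) after adjacent-v
  far′ : ∀ t t′ → t + 3 ≤ t′ → t′ ≤ suc T → 3 ≤ dist (append S T v t) (append S T v t′)
  far′ t t′ gap t′≤1+T with m≤n⇒m<n∨m≡n t′≤1+T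
  ... | inj₁ (s≤s t′≤T) = subst₂ (λ x y → 3 ≤ dist x y)
          (before (≤-trans (m≤m+n t 3) (≤-trans gap t′≤T))) (before t′≤T) (far t t′ gap t′≤T)
  ... | inj₂ refl = subst₂ (λ x y → 3 ≤ dist x y)
          (before (≤-trans (m≤m+n t 2) t+2≤T)) after (far-v t t+2≤T)
    where
    t+2≤T : t + 2 ≤ T
    t+2≤T = ≤-pred (subst (_≤ suc T) (+-suc t 2) gap)

no-return : ∀ {S : ℕ → Cube m} {T t} → Is3Snake m S T → 3 + t ≤ T → S (1 + t) ≢ S (3 + t)
no-return {S = S} {t = t} (adjacent , far) 3+t≤T S[1+t]≡S[3+t] =
  contradiction (subst (3 ≤_) dist≡1 (far t (3 + t) (≤-reflexive (+-comm t 3)) 3+t≤T)) λ { (s≤s ()) }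
  where
  dist≡1 : dist (S t) (S (3 + t)) ≡ 1
  dist≡1 = trans (cong (dist (S t)) (sym S[1+t]≡S[3+t])) (adjacent t (≤-trans (m≤n+m (suc t) 2) 3+t≤T))

last-steps : ∀ {R : ℕ → Cube m} {ℓ} → Is3Snake m R (3 + ℓ) →
             ∃₂ λ b c → b ≢ c × R (2 + ℓ) ≡ flip b (R (3 + ℓ)) × R (1 + ℓ) ≡ flip c (R (2 + ℓ))
last-steps {R = R} {ℓ} snake@(adjacent , _)
  with b , step₁ ← dist≡1⇒flip _ _ (adjacent (2 + ℓ) ≤-refl)
  with c , step₂ ← dist≡1⇒flip _ _ (adjacent (1 + ℓ) (n≤1+n _))
  = b , c , b≢c , step₁ , step₂
  where
  b≢c : b ≢ c
  b≢c refl = no-return {S = R} snake ≤-refl (trans step₂ (trans (cong (flip b) step₁) (flip-involutive b _)))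

snake-normal-form : ∀ {R : ℕ → Cube m} {ℓ} → Is3Snake m R (3 + ℓ) → (i j : Fin m) → i ≢ j →
  Σ (ℕ → Cube m) λ R′ → Is3Snake m R′ (3 + ℓ) ×
    R′ (3 + ℓ) ≡ zeros m × R′ (2 + ℓ) ≡ flip i (zeros m) × R′ (1 + ℓ) ≡ flip j (flip i (zeros m))
snake-normal-form {m = m} {R} {ℓ} snake i j i≢j
  with b , c , b≢c , step₁ , step₂ ← last-steps {R = R} snake
  with π , πb≡i , πc≡j ← permutation-sending b≢c i≢j
  = φ ∘ R , isometry-preserves-snake {φ = φ} φ-isometry {S = R} snake , end₀ , end₁ , end₂
  where
  open ≡-Reasoning
  z : Cube m
  z = R (3 + ℓ)
  φ : Cube m → Cube m
  φ x = permute π (translate z x)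
  φ-isometry : ∀ x y → dist (φ x) (φ y) ≡ dist x y
  φ-isometry x y = trans (dist-permute π (translate z x) (translate z y)) (dist-translate z x y)
  φ-flip : ∀ k x → φ (flip k x) ≡ flip (π ⟨$⟩ʳ k) (φ x)
  φ-flip k x = trans (cong (permute π) (translate-flip z k x)) (permute-flip π k (translate z x))
  end₀ : φ z ≡ zeros m
  end₀ = trans (cong (permute π) (translate-self z)) (permute-zeros π)
  end₁ : φ (R (2 + ℓ)) ≡ flip i (zeros m)
  end₁ = begin
    φ (R (2 + ℓ))                      ≡⟨ cong φ step₁ ⟩
    φ (flip b (R (3 + ℓ)))             ≡⟨ φ-flip b _ ⟩
    flip (π ⟨$⟩ʳ b) (φ (R (3 + ℓ)))    ≡⟨ cong₂ flip πb≡i end₀ ⟩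
    flip i (zeros m)                   ∎
  end₂ : φ (R (1 + ℓ)) ≡ flip j (flip i (zeros m))
  end₂ = begin
    φ (R (1 + ℓ))                      ≡⟨ cong φ step₂ ⟩
    φ (flip c (R (2 + ℓ)))             ≡⟨ φ-flip c _ ⟩
    flip (π ⟨$⟩ʳ c) (φ (R (2 + ℓ)))    ≡⟨ cong₂ flip πc≡j end₁ ⟩
    flip j (flip i (zeros m))          ∎

-- Existence of a longest snake

Is3Snake? : ∀ m S T → Dec (Is3Snake m S T)
Is3Snake? m S T = adjacent? ×-dec far?
  where
  adjacent? : Dec (∀ t → t < T → Adjacent (S t) (S (suc t)))
  adjacent? = map′ (λ h t → h {t}) (λ h {t} → h t) (allUpTo? (λ t → dist (S t) (S (suc t)) ≟ℕ 1) T)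
  far? : Dec (∀ t t′ → t + 3 ≤ t′ → t′ ≤ T → 3 ≤ dist (S t) (S t′))
  far? = map′
    (λ h t t′ gap t′≤T → h {t′} (s≤s t′≤T) {t} (s≤s (≤-trans (m≤m+n t 3) (≤-trans gap t′≤T))) gap)
    (λ h {t′} t′<1+T {t} _ gap → h t t′ gap (≤-pred t′<1+T))
    (allUpTo? (λ t′ → allUpTo? (λ t → t + 3 ≤? t′ →-dec 3 ≤? dist (S t) (S t′)) (suc T)) (suc T))

vectors : ∀ {A : Set} → List A → ∀ n → List (Vec A n)
vectors xs zero = [] ∷ []
vectors xs (suc n) = cartesianProductWith _∷_ xs (vectors xs n)

∈-vectors : ∀ {A : Set} {xs : List A} {n} → (∀ a → a ∈ xs) → (v : Vec A n) → v ∈ vectors xs n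
∈-vectors complete [] = here refl
∈-vectors complete (a ∷ v) = ∈-cartesianProductWith⁺ _∷_ (complete a) (∈-vectors complete v)

cubes : ∀ m → List (Cube m)
cubes m = vectors (true ∷ false ∷ []) m

∈-cubes : ∀ (x : Cube m) → x ∈ cubes m
∈-cubes = ∈-vectors λ { true → here refl ; false → there (here refl) }

walk : ∀ {A : Set} → Vec A (suc k) → ℕ → A
walk {k = zero} (a ∷ []) _ = a
walk {k = suc k} (a ∷ _) zero = a
walk {k = suc k} (_ ∷ v) (suc t) = walk v t

vertices : ∀ {A : Set} → (ℕ → A) → ∀ k → Vec A (suc k)
vertices S zero = S 0 ∷ []
vertices S (suc k) = S 0 ∷ vertices (S ∘ suc) k

walk-vertices : ∀ {A : Set} (S : ℕ → A) k {t} → t ≤ k → walk (vertices S k) t ≡ S t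
walk-vertices S zero z≤n = refl
walk-vertices S (suc k) z≤n = refl
walk-vertices S (suc k) (s≤s t≤k) = walk-vertices (S ∘ suc) k t≤k

snake? : ∀ m T → Dec (∃ λ S → Is3Snake m S T)
snake? m T = map′ (Product.map walk id ∘ satisfied) every-snake-listed
  (any? (λ v → Is3Snake? m (walk v) T) (vectors (cubes m) (suc T)))
  where
  every-snake-listed : (∃ λ S → Is3Snake m S T) →
                       Any.Any (λ v → Is3Snake m (walk v) T) (vectors (cubes m) (suc T))
  every-snake-listed (S , snake) = Any.map (λ { refl → Is3Snake-cong (sym ∘ walk-vertices S T) snake })
    (∈-vectors ∈-cubes (vertices S T))

-- Pigeonhole on the vertices S 0, S 3, S 6, …
snake-length-bound : ∀ {S : ℕ → Cube m} {T} → Is3Snake m S T → T ≤ 3 * length (cubes m)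
snake-length-bound {m = m} {S} {T} snake with T ≤? 3 * length (cubes m)
... | yes T≤3N = T≤3N
... | no T≰3N = contradiction (pigeonhole ≤-refl position) no-collision
  where
  position : Fin (suc (length (cubes m))) → Fin (length (cubes m))
  position i = Any.index (∈-cubes (S (3 * toℕ i)))
  no-collision : ¬ ∃₂ λ i j → i Fin.< j × position i ≡ position j
  no-collision (i , j , i<j , same) = far-distinct {S = S} snake gap 3j≤T (begin
    S (3 * toℕ i)                               ≡⟨ lookup-index (∈-cubes (S (3 * toℕ i))) ⟩
    lookup (cubes m) (position i)               ≡⟨ cong (lookup (cubes m)) same ⟩
    lookup (cubes m) (position j)               ≡⟨ lookup-index (∈-cubes (S (3 * toℕ j))) ⟨
    S (3 * toℕ j)                               ∎)
    where
    open ≡-Reasoning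
    gap : 3 * toℕ i + 3 ≤ 3 * toℕ j
    gap = subst (_≤ 3 * toℕ j) (trans (*-suc 3 (toℕ i)) (+-comm 3 (3 * toℕ i))) (*-monoʳ-≤ 3 i<j)
    3j≤T : 3 * toℕ j ≤ T
    3j≤T = ≤-trans (*-monoʳ-≤ 3 (≤-pred (toℕ<n j))) (<⇒≤ (≰⇒> T≰3N))

greatest : ∀ {P : ℕ → Set} → Decidable P → P 0 → ∀ b → (∀ {j} → P j → j ≤ b) →
           ∃ λ k → P k × (∀ {j} → P j → j ≤ k)
greatest P? p₀ zero bound = 0 , p₀ , bound
greatest P? p₀ (suc b) bound with P? (suc b)
... | yes p = suc b , p , bound
... | no ¬p = greatest P? p₀ b (λ pj → ≤-pred (≤∧≢⇒< (bound pj) λ { refl → ¬p pj }))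

stationary-snake : ∀ m → ∃ λ S → Is3Snake m S 0
stationary-snake m = (λ _ → zeros m) , (λ _ ()) ,
  λ t t′ gap t′≤0 → contradiction (≤-trans (m≤n+m 3 t) (≤-trans gap t′≤0)) λ ()

longest-snake : ∀ m → Σ (ℕ → Cube m) λ R → Σ ℕ λ L → Is3Snake m R L × MaxSnakeLength≤ m L
longest-snake m
  with L , (R , snake) , longest ← greatest (snake? m) (stationary-snake m) (3 * length (cubes m))
                                             (λ (S , snake) → snake-length-bound {S = S} snake)
  = R , L , snake , λ S T snake′ → longest (S , snake′)

staircase : ∀ k → ℕ → Cube (3 + k)
staircase k 0 = zeros _
staircase k 1 = flip zero (zeros _)
staircase k 2 = flip (suc zero) (flip zero (zeros _))
staircase k (suc (suc (suc _))) = flip (suc (suc zero)) (flip (suc zero) (flip zero (zeros _)))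

staircase-snake : ∀ k → Is3Snake (3 + k) (staircase k) 3
staircase-snake k = adjacent , far
  where
  adjacent : ∀ t → t < 3 → Adjacent (staircase k t) (staircase k (suc t))
  adjacent 0 _ = cong suc (dist[x,x]≡0 (zeros k))
  adjacent 1 _ = cong suc (dist[x,x]≡0 (zeros k))
  adjacent 2 _ = cong suc (dist[x,x]≡0 (zeros k))
  adjacent (suc (suc (suc _))) (s≤s (s≤s (s≤s ())))
  far : ∀ t t′ → t + 3 ≤ t′ → t′ ≤ 3 → 3 ≤ dist (staircase k t) (staircase k t′)
  far zero t′ gap t′≤3 with refl ← ≤-antisym t′≤3 gap = s≤s (s≤s (s≤s z≤n))
  far (suc t) t′ gap t′≤3 =
    contradiction (≤-trans (s≤s (m≤n+m 3 t)) (≤-trans gap t′≤3)) λ { (s≤s (s≤s (s≤s ()))) }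

exit-facet : (ℕ → Cube m) → ℕ → ℕ → Cube (suc m)
exit-facet R L = append ((true ∷_) ∘ R) L (false ∷ R L)

exit-facet-snake : ∀ {R : ℕ → Cube m} {L} → Is3Snake m R L → 3 ≤ L → Is3Snake (suc m) (exit-facet R L) (suc L)
exit-facet-snake {R = R} {L} snake 3≤L =
  append-snake {S = (true ∷_) ∘ R} (isometry-preserves-snake {φ = true ∷_} (λ _ _ → refl) {S = R} snake)
    (cong suc (dist[x,x]≡0 (R L))) (λ t t+2≤L → s≤s (dist-to-end {R = R} snake 3≤L t t+2≤L))

exit-facet-≤ : ∀ (R : ℕ → Cube m) L {t} → t ≤ L → exit-facet R L t ≡ true ∷ R t
exit-facet-≤ R L = append-≤ ((true ∷_) ∘ R) L (false ∷ R L)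

exit-facet-last : ∀ (R : ℕ → Cube m) L → exit-facet R L (suc L) ≡ false ∷ R L
exit-facet-last R L = append-last ((true ∷_) ∘ R) L (false ∷ R L)

lemma3p3 : (n : ℕ) → 6 ≤ n →
    Σ (ℕ → Cube n) λ S → Σ ℕ λ T →
      Is3Snake n S T × 3 ≤ T ×
      S (T ∸ 3) ≡ pt n (0 ∷ 2 ∷ 4 ∷ []) ×
      S (T ∸ 2) ≡ pt n (0 ∷ 2 ∷ []) ×
      S (T ∸ 1) ≡ pt n (0 ∷ []) ×
      S T ≡ pt n [] ×
      (∀ t → t + 3 < T → 3 < norm (S t)) ×
      MaxSnakeLength≤ (n ∸ 1) T
lemma3p3 _ (s≤s (s≤s (s≤s (s≤s (s≤s (s≤s {n = k} z≤n))))))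
  with R , _ , snake , longest ← longest-snake (5 + k)
  with s≤s (s≤s (s≤s {n = ℓ} z≤n)) ← longest (staircase (2 + k)) 3 (staircase-snake (2 + k))
  -- coordinates 1 and 3 of the facet are coordinates 2 and 4 of the whole cube
  = let R′ , snake′ , end₀ , end₁ , end₂ = snake-normal-form {R = R} snake (suc zero) (suc (suc (suc zero))) (λ ())
        L = 3 + ℓ
    in exit-facet R′ L , suc L
     , exit-facet-snake {R = R′} snake′ (s≤s (s≤s (s≤s z≤n))) , s≤s (s≤s (s≤s z≤n))
     , trans (exit-facet-≤ R′ L (m≤n+m (suc ℓ) 2)) (cong (true ∷_) end₂)
     , trans (exit-facet-≤ R′ L (n≤1+n (2 + ℓ))) (cong (true ∷_) end₁)
     , trans (exit-facet-≤ R′ L ≤-refl) (cong (true ∷_) end₀)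
     , trans (exit-facet-last R′ L) (cong (false ∷_) end₀)
     , (λ t t+3<T → subst ((3 <_) ∘ norm) (sym (exit-facet-≤ R′ L (≤-trans (m≤m+n t 3) (≤-pred t+3<T))))
                      (s≤s (norm-from-end {R = R′} snake′ end₀ (≤-pred t+3<T))))
     , λ S T snake → m≤n⇒m≤1+n (longest S T snake)
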